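{- For every integer $v>5$, writing $r_m=c_{2v,v-m}/c_{2v,v-1}$, $$\sum_{k=1}^{v-1}\frac{1}{k^8}=\frac{\pi^8}{9450}-\zeta(8,v)=\frac{8}{14175}\Big(350\,r_2^4-420\,r_3r_2^2+63\,r_3^2+60\,r_4r_2-5\,r_5\Big).$$
   Context: For a complex parameter $\rho$, the generalized cosecant numbers $c_{\rho,k}$ ($k=0,1,2,\dots$) are defined by the power series expansion about $z=0$: $(z/\sin z)^{\rho}=\sum_{k\ge 0}c_{\rho,k}z^{2k}$ (principal branch, equal to $1$ at $z=0$); here $\rho=2v$. $\zeta(s,a)=\sum_{n\ge0}(n+a)^{ -s}$ denotes the Hurwitz zeta function. -}

module Defs where

open import Data.Nat as ℕ using (ℕ; zero; suc; _!)
open import Data.Nat.Properties using (_!≢0)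
open import Data.Integer as ℤ using (ℤ; +_)
open import Data.Rational as Q using (ℚ; 0ℚ; 1ℚ; _+_; _*_; -_; _÷_)
open import Data.Rational.Properties using (_≟_)
open import Data.List using (List; []; _∷_; zipWith; map; upTo; foldr)
open import Relation.Nullary using (yes; no)

-- Total division on ℚ (x / 0 := 0); only ever applied to nonzero
-- denominators in the statement.
_⊘_ : ℚ → ℚ → ℚ
p ⊘ q with q ≟ 0ℚ
... | yes _ = 0ℚ
... | no q≢0 = _÷_ p q {{Q.≢-nonZero q≢0}}

fromℕ : ℕ → ℚ
fromℕ n = + n Q./ 1

sumℚ : List ℚ → ℚ
sumℚ = foldr _+_ 0ℚ

Σ< : ℕ → (ℕ → ℚ) → ℚ
Σ< n f = sumℚ (map f (upTo n))

_^ℚ_ : ℚ → ℕ → ℚ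
x ^ℚ zero = 1ℚ
x ^ℚ suc n = x * (x ^ℚ n)

Series : Set
Series = ℕ → ℚ

-- sin z / z = Σ_j (-1)^j z^{2j} / (2j+1)!, as a series in w = z².
sinc : Series
sinc j = ((- 1ℚ) ^ℚ j) * (_/_ (+ 1) ((1 ℕ.+ 2 ℕ.* j) !) {{(1 ℕ.+ 2 ℕ.* j) !≢0}})
  where open Q using (_/_)

-- Reversed list [g_n, …, g_0] of the coefficients of g = 1 / sinc
-- (g_0 = 1, g_n = - Σ_{j=1}^{n} sinc_j g_{n-j}).
invSincRev : ℕ → List ℚ
invSincRev zero = 1ℚ ∷ []
invSincRev (suc n) =
  (- sumℚ (zipWith _*_ (map (λ i → sinc (suc i)) (upTo (suc n))) (invSincRev n)))
  ∷ invSincRev n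

head0 : List ℚ → ℚ
head0 [] = 0ℚ
head0 (x ∷ _) = x

invSinc : Series
invSinc n = head0 (invSincRev n)

_⊛_ : Series → Series → Series
(f ⊛ g) n = Σ< (suc n) (λ i → f i * g (n ℕ.∸ i))

one : Series
one zero = 1ℚ
one (suc _) = 0ℚ

_^S_ : Series → ℕ → Series
f ^S zero = one
f ^S suc m = f ⊛ (f ^S m)

-- Generalized cosecant numbers for integer ρ ≥ 0:
-- (z / sin z)^ρ = Σ_k c ρ k · z^{2k}
c : ℕ → ℕ → ℚ
c ρ k = (invSinc ^S ρ) k

{-# OPTIONS --safe #-}
module Submission where

-- Work with formal power series in w = z² over ℚ, with the Euler operator θ = w d/dw, which is a
-- derivation.  For S = sin z / z, the equations sin'' = −sin and cos² + sin² = 1 become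
-- 4θ²S + 2θS + wS = 0 and (S + 2θS)² + wS² = 1.  Hence T = θS / S satisfies the Riccati equation
-- 4θT = −(4T² + 2T + w) and S⁻² = (1 + 2T)² + w, while θ(S^−ρ) = −ρ S^−ρ T.  Together these give
--   ρ(ρ+1) c_{ρ+2,k} = (2k − ρ)(2k − ρ − 1) c_{ρ,k} + ρ² c_{ρ,k−1}.
-- For ρ = 2n and k = n − m the first factor is 2m(2m+1), and induction on n yields
-- c_{2n,n−1−j} = K_j e_j(1/1², …, 1/(n−1)²) c_{2n,n−1} with K_j = (2j+1)!/4^j and e_j the elementary
-- symmetric polynomials.  Newton's identity writes Σ_k 1/k⁸ in terms of e₁, …, e₄.

open import Defs
open import Data.Nat as ℕ using (ℕ; zero; suc; _∸_; _<_; _≤_; _!; z≤n; s≤s)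
open import Data.Nat.Properties using (_!≢0)
import Data.Nat.Coprimality as Coprime
import Data.Nat.Properties as ℕ
import Data.Integer as ℤ
import Data.Integer.Properties as ℤ
open import Data.Rational as ℚ using (ℚ; mkℚ; 0ℚ; 1ℚ; _+_; _-_; _*_; -_)
import Data.Rational.Properties as ℚ
open import Data.Rational.Unnormalised as ℚᵘ using (mkℚᵘ; *≡*; 1ℚᵘ) renaming (_≃_ to _≃ᵘ_)
import Data.Rational.Unnormalised.Properties as ℚᵘ
open import Data.Rational.Solver using (module +-*-Solver)
open import Data.List using (_∷_; map; upTo; applyUpTo; zipWith)
open import Data.List.Properties using (map-applyUpTo; map-upTo)
open import Data.Empty using (⊥-elim)
open import Data.Maybe using (Maybe; just; nothing)
open import Data.Product using (_,_)
open import Data.Sum using (inj₁; inj₂)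
open import Algebra.Structures using (IsCommutativeRing)
open import Algebra.Bundles using (CommutativeRing)
import Algebra.Construct.Pointwise ℕ as Pointwise
open import Algebra.Solver.Ring.AlmostCommutativeRing using (fromCommutativeRing; _-Raw-AlmostCommutative⟶_)
import Algebra.Solver.Ring
open import Function using (_∘_; id)
open import Relation.Nullary using (yes; no)
open import Relation.Binary.PropositionalEquality
open ≡-Reasoning

open +-*-Solver using (solve; _:+_; _:*_; _:-_; :-_; _:=_; con)

fromℕ≡mkℚ : ∀ n → fromℕ n ≡ mkℚ (ℤ.+ n) 0 (Coprime.sym (Coprime.1-coprimeTo n))
fromℕ≡mkℚ n = ℚ.normalize-coprime (Coprime.sym (Coprime.1-coprimeTo n))

fromℕ-toℚᵘ : ∀ n → ℚ.toℚᵘ (fromℕ n) ≃ᵘ mkℚᵘ (ℤ.+ n) 0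
fromℕ-toℚᵘ n = ℚ.toℚᵘ-cong (fromℕ≡mkℚ n)

fromℕ-suc : ∀ n → fromℕ (suc n) ≡ 1ℚ + fromℕ n
fromℕ-suc n = ℚ.toℚᵘ-injective (ℚᵘ.≃-trans (fromℕ-toℚᵘ (suc n)) (ℚᵘ.≃-trans (*≡* numerators)
  (ℚᵘ.≃-sym (ℚᵘ.≃-trans (ℚ.toℚᵘ-homo-+ 1ℚ (fromℕ n)) (ℚᵘ.+-congʳ 1ℚᵘ (fromℕ-toℚᵘ n))))))
  where
  numerators : ℤ.+ suc n ℤ.* ℤ.+ 1 ≡ (ℤ.+ 1 ℤ.+ ℤ.+ n ℤ.* ℤ.+ 1) ℤ.* ℤ.+ 1
  numerators = trans (ℤ.*-identityʳ _)
    (sym (trans (ℤ.*-identityʳ _) (cong (λ m → ℤ.+ 1 ℤ.+ m) (ℤ.*-identityʳ (ℤ.+ n)))))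

fromℕ-+ : ∀ m n → fromℕ (m ℕ.+ n) ≡ fromℕ m + fromℕ n
fromℕ-+ zero    n = sym (ℚ.+-identityˡ (fromℕ n))
fromℕ-+ (suc m) n = begin
  fromℕ (suc (m ℕ.+ n))        ≡⟨ fromℕ-suc (m ℕ.+ n) ⟩
  1ℚ + fromℕ (m ℕ.+ n)         ≡⟨ cong (1ℚ +_) (fromℕ-+ m n) ⟩
  1ℚ + (fromℕ m + fromℕ n)     ≡⟨ ℚ.+-assoc 1ℚ (fromℕ m) (fromℕ n) ⟨
  (1ℚ + fromℕ m) + fromℕ n     ≡⟨ cong (_+ fromℕ n) (fromℕ-suc m) ⟨
  fromℕ (suc m) + fromℕ n      ∎

fromℕ-* : ∀ m n → fromℕ (m ℕ.* n) ≡ fromℕ m * fromℕ n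
fromℕ-* zero    n = sym (ℚ.*-zeroˡ (fromℕ n))
fromℕ-* (suc m) n = begin
  fromℕ (n ℕ.+ m ℕ.* n)             ≡⟨ fromℕ-+ n (m ℕ.* n) ⟩
  fromℕ n + fromℕ (m ℕ.* n)         ≡⟨ cong (fromℕ n +_) (fromℕ-* m n) ⟩
  fromℕ n + fromℕ m * fromℕ n       ≡⟨ solve 2 (λ a b → b :+ a :* b := (con 1ℚ :+ a) :* b)
                                                refl (fromℕ m) (fromℕ n) ⟩
  (1ℚ + fromℕ m) * fromℕ n          ≡⟨ cong (_* fromℕ n) (fromℕ-suc m) ⟨
  fromℕ (suc m) * fromℕ n           ∎

fromℕ-affine : ∀ a b n → fromℕ (a ℕ.+ b ℕ.* n) ≡ fromℕ a + fromℕ b * fromℕ n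
fromℕ-affine a b n = trans (fromℕ-+ a (b ℕ.* n)) (cong (fromℕ a +_) (fromℕ-* b n))

fromℕ≢0 : ∀ n .{{_ : ℕ.NonZero n}} → fromℕ n ≢ 0ℚ
fromℕ≢0 (suc n) eq with trans (sym (fromℕ≡mkℚ (suc n))) eq
... | ()

*-cancelʳ-≢0 : ∀ {p q} r → r ≢ 0ℚ → p * r ≡ q * r → p ≡ q
*-cancelʳ-≢0 {p} {q} r r≢0 eq = begin
  p                  ≡⟨ ℚ.*-identityʳ p ⟨
  p * 1ℚ             ≡⟨ cong (p *_) (ℚ.*-inverseʳ r) ⟨
  p * (r * ℚ.1/ r)   ≡⟨ ℚ.*-assoc p r _ ⟨
  p * r * ℚ.1/ r     ≡⟨ cong (_* ℚ.1/ r) eq ⟩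
  q * r * ℚ.1/ r     ≡⟨ ℚ.*-assoc q r _ ⟩
  q * (r * ℚ.1/ r)   ≡⟨ cong (q *_) (ℚ.*-inverseʳ r) ⟩
  q * 1ℚ             ≡⟨ ℚ.*-identityʳ q ⟩
  q                  ∎
  where instance _ = ℚ.≢-nonZero r≢0

*-cancelˡ-≢0 : ∀ {p q} r → r ≢ 0ℚ → r * p ≡ r * q → p ≡ q
*-cancelˡ-≢0 {p} {q} r r≢0 eq =
  *-cancelʳ-≢0 r r≢0 (trans (ℚ.*-comm p r) (trans eq (ℚ.*-comm r q)))

*-≢0 : ∀ {p q} → p ≢ 0ℚ → q ≢ 0ℚ → p * q ≢ 0ℚ
*-≢0 {p} {q} p≢0 q≢0 pq≡0 = p≢0 (*-cancelʳ-≢0 q q≢0 (trans pq≡0 (sym (ℚ.*-zeroˡ q))))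

⊘-*-cancel : ∀ p {q} → q ≢ 0ℚ → (p ⊘ q) * q ≡ p
⊘-*-cancel p {q} q≢0 with q ℚ.≟ 0ℚ
... | yes q≡0 = ⊥-elim (q≢0 q≡0)
... | no q≢0′ = begin
  p * ℚ.1/ q * q     ≡⟨ ℚ.*-assoc p _ q ⟩
  p * (ℚ.1/ q * q)   ≡⟨ cong (p *_) (ℚ.*-inverseˡ q) ⟩
  p * 1ℚ             ≡⟨ ℚ.*-identityʳ p ⟩
  p                  ∎
  where instance _ = ℚ.≢-nonZero q≢0′

⊘-unique : ∀ {p q y} → q ≢ 0ℚ → y * q ≡ p → p ⊘ q ≡ y
⊘-unique {p} {q} q≢0 eq = *-cancelʳ-≢0 q q≢0 (trans (⊘-*-cancel p q≢0) (sym eq))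

1/n*n≡1 : ∀ n .{{_ : ℕ.NonZero n}} → (ℤ.+ 1 ℚ./ n) * fromℕ n ≡ 1ℚ
1/n*n≡1 (suc k) = begin
  (ℤ.+ 1 ℚ./ suc k) * fromℕ (suc k)
    ≡⟨ cong₂ _*_ (ℚ.normalize-coprime (Coprime.1-coprimeTo (suc k))) (fromℕ≡mkℚ (suc k)) ⟩
  ℚ.1/ suc-k/1 * suc-k/1
    ≡⟨ ℚ.*-inverseˡ suc-k/1 ⟩
  1ℚ ∎
  where suc-k/1 = mkℚ (ℤ.+ suc k) 0 (Coprime.sym (Coprime.1-coprimeTo (suc k)))

1/_! : ℕ → ℚ
1/ n ! = (ℤ.+ 1 ℚ./ n !) {{n !≢0}}

1/[2+n]!*[1+n]*[2+n]≡1/n! : ∀ n → 1/ (2 ℕ.+ n) ! * (fromℕ (1 ℕ.+ n) * fromℕ (2 ℕ.+ n)) ≡ 1/ n !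
1/[2+n]!*[1+n]*[2+n]≡1/n! n = *-cancelʳ-≢0 (fromℕ (n !)) (fromℕ≢0 (n !) {{n !≢0}}) (begin
  1/ (2 ℕ.+ n) ! * (fromℕ (1 ℕ.+ n) * fromℕ (2 ℕ.+ n)) * fromℕ (n !)
    ≡⟨ solve 4 (λ u a b c → u :* (a :* b) :* c := u :* (b :* (a :* c)))
         refl (1/ (2 ℕ.+ n) !) (fromℕ (1 ℕ.+ n)) (fromℕ (2 ℕ.+ n)) (fromℕ (n !)) ⟩
  1/ (2 ℕ.+ n) ! * (fromℕ (2 ℕ.+ n) * (fromℕ (1 ℕ.+ n) * fromℕ (n !)))
    ≡⟨ cong (λ x → 1/ (2 ℕ.+ n) ! * (fromℕ (2 ℕ.+ n) * x)) (fromℕ-* (1 ℕ.+ n) (n !)) ⟨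
  1/ (2 ℕ.+ n) ! * (fromℕ (2 ℕ.+ n) * fromℕ ((1 ℕ.+ n) !))
    ≡⟨ cong (1/ (2 ℕ.+ n) ! *_) (fromℕ-* (2 ℕ.+ n) ((1 ℕ.+ n) !)) ⟨
  1/ (2 ℕ.+ n) ! * fromℕ ((2 ℕ.+ n) !)
    ≡⟨ 1/n*n≡1 ((2 ℕ.+ n) !) {{(2 ℕ.+ n) !≢0}} ⟩
  1ℚ
    ≡⟨ 1/n*n≡1 (n !) {{n !≢0}} ⟨
  1/ n ! * fromℕ (n !) ∎)

Σ<-suc : ∀ n f → Σ< (suc n) f ≡ f 0 + Σ< n (f ∘ suc)
Σ<-suc n f = cong (λ xs → f 0 + sumℚ xs)
  (trans (map-applyUpTo suc f n) (sym (map-applyUpTo id (f ∘ suc) n)))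

Σ<-snoc : ∀ n f → Σ< (suc n) f ≡ Σ< n f + f n
Σ<-snoc zero    f = trans (ℚ.+-identityʳ (f 0)) (sym (ℚ.+-identityˡ (f 0)))
Σ<-snoc (suc n) f = begin
  Σ< (suc (suc n)) f                   ≡⟨ Σ<-suc (suc n) f ⟩
  f 0 + Σ< (suc n) (f ∘ suc)           ≡⟨ cong (f 0 +_) (Σ<-snoc n (f ∘ suc)) ⟩
  f 0 + (Σ< n (f ∘ suc) + f (suc n))   ≡⟨ ℚ.+-assoc (f 0) _ _ ⟨
  f 0 + Σ< n (f ∘ suc) + f (suc n)     ≡⟨ cong (_+ f (suc n)) (Σ<-suc n f) ⟨
  Σ< (suc n) f + f (suc n)             ∎

Σ<-cong : ∀ n {f g} → (∀ {i} → i < n → f i ≡ g i) → Σ< n f ≡ Σ< n g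
Σ<-cong zero    f≗g = refl
Σ<-cong (suc n) {f} {g} f≗g = begin
  Σ< (suc n) f             ≡⟨ Σ<-suc n f ⟩
  f 0 + Σ< n (f ∘ suc)     ≡⟨ cong₂ _+_ (f≗g (s≤s z≤n)) (Σ<-cong n (f≗g ∘ s≤s)) ⟩
  g 0 + Σ< n (g ∘ suc)     ≡⟨ Σ<-suc n g ⟨
  Σ< (suc n) g             ∎

Σ<-+ : ∀ n f g → Σ< n (λ i → f i + g i) ≡ Σ< n f + Σ< n g
Σ<-+ zero    f g = sym (ℚ.+-identityˡ 0ℚ)
Σ<-+ (suc n) f g = begin
  Σ< (suc n) (λ i → f i + g i)
    ≡⟨ Σ<-suc n (λ i → f i + g i) ⟩
  (f 0 + g 0) + Σ< n (λ i → f (suc i) + g (suc i))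
    ≡⟨ cong (f 0 + g 0 +_) (Σ<-+ n (f ∘ suc) (g ∘ suc)) ⟩
  (f 0 + g 0) + (Σ< n (f ∘ suc) + Σ< n (g ∘ suc))
    ≡⟨ solve 4 (λ a b c d → (a :+ b) :+ (c :+ d) := (a :+ c) :+ (b :+ d))
         refl (f 0) (g 0) (Σ< n (f ∘ suc)) (Σ< n (g ∘ suc)) ⟩
  (f 0 + Σ< n (f ∘ suc)) + (g 0 + Σ< n (g ∘ suc))
    ≡⟨ cong₂ _+_ (Σ<-suc n f) (Σ<-suc n g) ⟨
  Σ< (suc n) f + Σ< (suc n) g ∎

Σ<-*ˡ : ∀ n a f → Σ< n (λ i → a * f i) ≡ a * Σ< n f
Σ<-*ˡ zero    a f = sym (ℚ.*-zeroʳ a)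
Σ<-*ˡ (suc n) a f = begin
  Σ< (suc n) (λ i → a * f i)           ≡⟨ Σ<-suc n (λ i → a * f i) ⟩
  a * f 0 + Σ< n (λ i → a * f (suc i)) ≡⟨ cong (a * f 0 +_) (Σ<-*ˡ n a (f ∘ suc)) ⟩
  a * f 0 + a * Σ< n (f ∘ suc)         ≡⟨ ℚ.*-distribˡ-+ a (f 0) _ ⟨
  a * (f 0 + Σ< n (f ∘ suc))           ≡⟨ cong (a *_) (Σ<-suc n f) ⟨
  a * Σ< (suc n) f                     ∎

Σ<-reverse : ∀ n f → Σ< (suc n) f ≡ Σ< (suc n) (λ i → f (n ∸ i))
Σ<-reverse zero    f = refl
Σ<-reverse (suc n) f = begin
  Σ< (suc (suc n)) f                              ≡⟨ Σ<-snoc (suc n) f ⟩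
  Σ< (suc n) f + f (suc n)                        ≡⟨ cong (_+ f (suc n)) (Σ<-reverse n f) ⟩
  Σ< (suc n) (λ i → f (n ∸ i)) + f (suc n)        ≡⟨ ℚ.+-comm _ (f (suc n)) ⟩
  f (suc n) + Σ< (suc n) (λ i → f (n ∸ i))        ≡⟨ Σ<-suc (suc n) (λ i → f (suc n ∸ i)) ⟨
  Σ< (suc (suc n)) (λ i → f (suc n ∸ i))          ∎

zipWith-applyUpTo : ∀ {A B C : Set} (_∙_ : A → B → C) f g n →
                    zipWith _∙_ (applyUpTo f n) (applyUpTo g n) ≡ applyUpTo (λ i → f i ∙ g i) n
zipWith-applyUpTo _∙_ f g zero    = refl
zipWith-applyUpTo _∙_ f g (suc n) = cong (f 0 ∙ g 0 ∷_) (zipWith-applyUpTo _∙_ (f ∘ suc) (g ∘ suc) n)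

-- The ring of formal power series

infix  4 _≋_
infixl 6 _⊕_
infix  25 ⊖_
infixr 7 _∙_

_≋_ : Series → Series → Set
f ≋ g = ∀ n → f n ≡ g n

_⊕_ : Series → Series → Series
(f ⊕ g) n = f n + g n

⊖_ : Series → Series
(⊖ f) n = - f n

𝟘 : Series
𝟘 _ = 0ℚ

_∙_ : ℚ → Series → Series
(a ∙ f) n = a * f n

tail : Series → Series
tail f n = f (suc n)

⊛-head : ∀ f g → (f ⊛ g) 0 ≡ f 0 * g 0
⊛-head f g = ℚ.+-identityʳ (f 0 * g 0)

⊛-suc : ∀ f g n → (f ⊛ g) (suc n) ≡ f 0 * g (suc n) + (tail f ⊛ g) n
⊛-suc f g n = Σ<-suc (suc n) (λ i → f i * g (suc n ∸ i))

⊛-cong : ∀ {f f′ g g′} → f ≋ f′ → g ≋ g′ → f ⊛ g ≋ f′ ⊛ g′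
⊛-cong f≋f′ g≋g′ n = Σ<-cong (suc n) (λ {i} _ → cong₂ _*_ (f≋f′ i) (g≋g′ (n ∸ i)))

⊛-distribʳ : ∀ f g h → (f ⊕ g) ⊛ h ≋ (f ⊛ h) ⊕ (g ⊛ h)
⊛-distribʳ f g h n = trans
  (Σ<-cong (suc n) (λ {i} _ → ℚ.*-distribʳ-+ (h (n ∸ i)) (f i) (g i)))
  (Σ<-+ (suc n) (λ i → f i * h (n ∸ i)) (λ i → g i * h (n ∸ i)))

∙-⊛ : ∀ a f g → (a ∙ f) ⊛ g ≋ a ∙ (f ⊛ g)
∙-⊛ a f g n = trans
  (Σ<-cong (suc n) (λ {i} _ → ℚ.*-assoc a (f i) (g (n ∸ i))))
  (Σ<-*ˡ (suc n) a (λ i → f i * g (n ∸ i)))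

⊛-zeroˡ : ∀ g → 𝟘 ⊛ g ≋ 𝟘
⊛-zeroˡ g n = trans (Σ<-*ˡ (suc n) 0ℚ (λ i → g (n ∸ i))) (ℚ.*-zeroˡ (Σ< (suc n) (λ i → g (n ∸ i))))

⊛-comm : ∀ f g → f ⊛ g ≋ g ⊛ f
⊛-comm f g n = begin
  Σ< (suc n) (λ i → f i * g (n ∸ i))                ≡⟨ Σ<-reverse n (λ i → f i * g (n ∸ i)) ⟩
  Σ< (suc n) (λ i → f (n ∸ i) * g (n ∸ (n ∸ i)))    ≡⟨ Σ<-cong (suc n) swap ⟩
  Σ< (suc n) (λ i → g i * f (n ∸ i))                ∎
  where
  swap : ∀ {i} → i < suc n → f (n ∸ i) * g (n ∸ (n ∸ i)) ≡ g i * f (n ∸ i)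
  swap {i} (s≤s i≤n) = trans (ℚ.*-comm (f (n ∸ i)) _) (cong (λ j → g j * f (n ∸ i)) (ℕ.m∸[m∸n]≡n i≤n))

⊛-assoc : ∀ f g h → (f ⊛ g) ⊛ h ≋ f ⊛ (g ⊛ h)
⊛-assoc f g h zero = begin
  (f ⊛ g) 0 * h 0 + 0ℚ    ≡⟨ cong (λ x → x * h 0 + 0ℚ) (⊛-head f g) ⟩
  f 0 * g 0 * h 0 + 0ℚ    ≡⟨ cong (_+ 0ℚ) (ℚ.*-assoc (f 0) (g 0) (h 0)) ⟩
  f 0 * (g 0 * h 0) + 0ℚ  ≡⟨ cong (λ x → f 0 * x + 0ℚ) (⊛-head g h) ⟨
  f 0 * (g ⊛ h) 0 + 0ℚ    ∎
⊛-assoc f g h (suc n) = begin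
  ((f ⊛ g) ⊛ h) (suc n)
    ≡⟨ ⊛-suc (f ⊛ g) h n ⟩
  (f ⊛ g) 0 * h (suc n) + (tail (f ⊛ g) ⊛ h) n
    ≡⟨ cong₂ (λ x y → x * h (suc n) + y) (⊛-head f g) (⊛-cong {g = h} (⊛-suc f g) (λ _ → refl) n) ⟩
  f 0 * g 0 * h (suc n) + (((f 0 ∙ tail g) ⊕ (tail f ⊛ g)) ⊛ h) n
    ≡⟨ cong (f 0 * g 0 * h (suc n) +_) (⊛-distribʳ (f 0 ∙ tail g) (tail f ⊛ g) h n) ⟩
  f 0 * g 0 * h (suc n) + (((f 0 ∙ tail g) ⊛ h) n + ((tail f ⊛ g) ⊛ h) n)
    ≡⟨ cong (f 0 * g 0 * h (suc n) +_) (cong₂ _+_ (∙-⊛ (f 0) (tail g) h n) (⊛-assoc (tail f) g h n)) ⟩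
  f 0 * g 0 * h (suc n) + (f 0 * (tail g ⊛ h) n + (tail f ⊛ (g ⊛ h)) n)
    ≡⟨ solve 5 (λ a b c d e → a :* b :* c :+ (a :* d :+ e) := a :* (b :* c :+ d) :+ e)
         refl (f 0) (g 0) (h (suc n)) ((tail g ⊛ h) n) ((tail f ⊛ (g ⊛ h)) n) ⟩
  f 0 * (g 0 * h (suc n) + (tail g ⊛ h) n) + (tail f ⊛ (g ⊛ h)) n
    ≡⟨ cong (λ x → f 0 * x + (tail f ⊛ (g ⊛ h)) n) (⊛-suc g h n) ⟨
  f 0 * (g ⊛ h) (suc n) + (tail f ⊛ (g ⊛ h)) n
    ≡⟨ ⊛-suc f (g ⊛ h) n ⟨
  (f ⊛ (g ⊛ h)) (suc n) ∎

constant : ℚ → Series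
constant a zero    = a
constant a (suc _) = 0ℚ

constant-⊛ : ∀ a f → constant a ⊛ f ≋ a ∙ f
constant-⊛ a f n = begin
  (constant a ⊛ f) n                          ≡⟨ Σ<-suc n (λ i → constant a i * f (n ∸ i)) ⟩
  a * f n + Σ< n (λ i → 0ℚ * f′ i)            ≡⟨ cong (a * f n +_) (Σ<-*ˡ n 0ℚ f′) ⟩
  a * f n + 0ℚ * Σ< n f′                      ≡⟨ cong (a * f n +_) (ℚ.*-zeroˡ (Σ< n f′)) ⟩
  a * f n + 0ℚ                                ≡⟨ ℚ.+-identityʳ (a * f n) ⟩
  a * f n                                     ∎
  where f′ = λ i → f (n ∸ suc i)

⟨_⟩ : ℕ → Series
⟨ k ⟩ = constant (fromℕ k)

constant-0 : ⟨ 0 ⟩ ≋ 𝟘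
constant-0 zero    = refl
constant-0 (suc n) = refl

⟨suc⟩ : ∀ ρ → ⟨ suc ρ ⟩ ≋ ⟨ 1 ⟩ ⊕ ⟨ ρ ⟩
⟨suc⟩ ρ zero    = fromℕ-suc ρ
⟨suc⟩ ρ (suc n) = sym (ℚ.+-identityˡ 0ℚ)

one≋constant-1 : one ≋ constant 1ℚ
one≋constant-1 zero    = refl
one≋constant-1 (suc n) = refl

⊛-identityˡ : ∀ f → one ⊛ f ≋ f
⊛-identityˡ f n =
  trans (⊛-cong {g = f} one≋constant-1 (λ _ → refl) n) (trans (constant-⊛ 1ℚ f n) (ℚ.*-identityˡ (f n)))

⊛-isCommutativeRing : IsCommutativeRing _≋_ _⊕_ _⊛_ ⊖_ 𝟘 one
⊛-isCommutativeRing = record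
  { isRing = record
    { +-isAbelianGroup = Pointwise.isAbelianGroup ℚ.+-0-isAbelianGroup
    ; *-cong           = ⊛-cong
    ; *-assoc          = ⊛-assoc
    ; *-identity       = ⊛-identityˡ , λ f n → trans (⊛-comm f one n) (⊛-identityˡ f n)
    ; distrib          = (λ f g h n → trans (⊛-comm f (g ⊕ h) n) (trans (⊛-distribʳ g h f n)
                                        (cong₂ _+_ (⊛-comm g f n) (⊛-comm h f n))))
                       , (λ h f g → ⊛-distribʳ f g h)
    }
  ; *-comm = ⊛-comm
  }

seriesRing : CommutativeRing _ _
seriesRing = record { isCommutativeRing = ⊛-isCommutativeRing }

open CommutativeRing seriesRing using () renaming (refl to ≋-refl; sym to ≋-sym; trans to ≋-trans)

⊛-congˡ : ∀ f {g g′} → g ≋ g′ → f ⊛ g ≋ f ⊛ g′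
⊛-congˡ f = ⊛-cong {f} {f} ≋-refl

⊛-congʳ : ∀ g {f f′} → f ≋ f′ → f ⊛ g ≋ f′ ⊛ g
⊛-congʳ g f≋f′ = ⊛-cong {g = g} {g} f≋f′ ≋-refl

⊕-congˡ : ∀ f {g g′} → g ≋ g′ → f ⊕ g ≋ f ⊕ g′
⊕-congˡ f g≋g′ n = cong (f n +_) (g≋g′ n)

⊕-congʳ : ∀ g {f f′} → f ≋ f′ → f ⊕ g ≋ f′ ⊕ g
⊕-congʳ g f≋f′ n = cong (_+ g n) (f≋f′ n)

⊖-cong : ∀ {f f′} → f ≋ f′ → ⊖ f ≋ ⊖ f′
⊖-cong f≋f′ n = cong -_ (f≋f′ n)

constant-homomorphism : CommutativeRing.rawRing ℚ.+-*-commutativeRing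
                          -Raw-AlmostCommutative⟶ fromCommutativeRing seriesRing
constant-homomorphism = record
  { ⟦_⟧    = constant
  ; +-homo = λ a b → λ { zero → refl ; (suc n) → sym (ℚ.+-identityˡ 0ℚ) }
  ; *-homo = λ a b → λ { zero → sym (constant-⊛ a (constant b) 0)
                       ; (suc n) → sym (trans (constant-⊛ a (constant b) (suc n)) (ℚ.*-zeroʳ a)) }
  ; -‿homo = λ a → λ { zero → refl ; (suc n) → refl }
  ; 0-homo = constant-0
  ; 1-homo = ≋-sym one≋constant-1
  }

constant-≟ : ∀ a b → Maybe (constant a ≋ constant b)
constant-≟ a b with a ℚ.≟ b
... | yes refl = just ≋-refl
... | no  _    = nothing

module SeriesSolver = Algebra.Solver.Ring (CommutativeRing.rawRing ℚ.+-*-commutativeRing)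
  (fromCommutativeRing seriesRing) constant-homomorphism constant-≟
open SeriesSolver using () renaming
  (solve to series-solve; _:+_ to _:⊕_; _:*_ to _:⊛_; :-_ to :⊖_; _:=_ to _:≋_)

:⟨_⟩ : ∀ {m} → ℕ → SeriesSolver.Polynomial m
:⟨ k ⟩ = SeriesSolver.con (fromℕ k)

-- The Euler operator

θ : Series → Series
θ f n = fromℕ n * f n

θ-cong : ∀ {f g} → f ≋ g → θ f ≋ θ g
θ-cong f≋g n = cong (fromℕ n *_) (f≋g n)

θ-⊕ : ∀ f g → θ (f ⊕ g) ≋ θ f ⊕ θ g
θ-⊕ f g n = ℚ.*-distribˡ-+ (fromℕ n) (f n) (g n)

θ-⊖ : ∀ f → θ (⊖ f) ≋ ⊖ θ f
θ-⊖ f n = sym (ℚ.neg-distribʳ-* (fromℕ n) (f n))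

θ-constant : ∀ a → θ (constant a) ≋ 𝟘
θ-constant a zero    = ℚ.*-zeroˡ a
θ-constant a (suc n) = ℚ.*-zeroʳ (fromℕ (suc n))

θ-⊛ : ∀ f g → θ (f ⊛ g) ≋ (θ f ⊛ g) ⊕ (f ⊛ θ g)
θ-⊛ f g n = begin
  fromℕ n * Σ< (suc n) (λ i → f i * g (n ∸ i))
    ≡⟨ Σ<-*ˡ (suc n) (fromℕ n) (λ i → f i * g (n ∸ i)) ⟨
  Σ< (suc n) (λ i → fromℕ n * (f i * g (n ∸ i)))
    ≡⟨ Σ<-cong (suc n) split ⟩
  Σ< (suc n) (λ i → fromℕ i * f i * g (n ∸ i) + f i * (fromℕ (n ∸ i) * g (n ∸ i)))
    ≡⟨ Σ<-+ (suc n) (λ i → fromℕ i * f i * g (n ∸ i)) (λ i → f i * (fromℕ (n ∸ i) * g (n ∸ i))) ⟩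
  ((θ f ⊛ g) ⊕ (f ⊛ θ g)) n ∎
  where
  split : ∀ {i} → i < suc n →
          fromℕ n * (f i * g (n ∸ i)) ≡ fromℕ i * f i * g (n ∸ i) + f i * (fromℕ (n ∸ i) * g (n ∸ i))
  split {i} (s≤s i≤n) = begin
    fromℕ n * (f i * g (n ∸ i))
      ≡⟨ cong (λ m → fromℕ m * (f i * g (n ∸ i))) (ℕ.m+[n∸m]≡n i≤n) ⟨
    fromℕ (i ℕ.+ (n ∸ i)) * (f i * g (n ∸ i))
      ≡⟨ cong (_* (f i * g (n ∸ i))) (fromℕ-+ i (n ∸ i)) ⟩
    (fromℕ i + fromℕ (n ∸ i)) * (f i * g (n ∸ i))
      ≡⟨ solve 4 (λ a b x y → (a :+ b) :* (x :* y) := a :* x :* y :+ x :* (b :* y))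
           refl (fromℕ i) (fromℕ (n ∸ i)) (f i) (g (n ∸ i)) ⟩
    fromℕ i * f i * g (n ∸ i) + f i * (fromℕ (n ∸ i) * g (n ∸ i)) ∎

θ-constant-⊛ : ∀ a f → θ (constant a ⊛ f) ≋ constant a ⊛ θ f
θ-constant-⊛ a f n = begin
  θ (constant a ⊛ f) n                                ≡⟨ θ-⊛ (constant a) f n ⟩
  (θ (constant a) ⊛ f) n + (constant a ⊛ θ f) n       ≡⟨ cong (_+ (constant a ⊛ θ f) n)
                                                            (trans (⊛-congʳ f (θ-constant a) n) (⊛-zeroˡ f n)) ⟩
  0ℚ + (constant a ⊛ θ f) n                           ≡⟨ ℚ.+-identityˡ _ ⟩
  (constant a ⊛ θ f) n                                ∎

θ-^S : ∀ {f L} ρ → θ f ≋ f ⊛ L → θ (f ^S ρ) ≋ ⟨ ρ ⟩ ⊛ ((f ^S ρ) ⊛ L)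
θ-^S {f} {L} zero θf≋fL n = begin
  θ one n                      ≡⟨ θ-cong one≋constant-1 n ⟩
  θ (constant 1ℚ) n            ≡⟨ θ-constant 1ℚ n ⟩
  0ℚ                           ≡⟨ ℚ.*-zeroˡ ((one ⊛ L) n) ⟨
  0ℚ * (one ⊛ L) n             ≡⟨ constant-⊛ 0ℚ (one ⊛ L) n ⟨
  (⟨ 0 ⟩ ⊛ (one ⊛ L)) n        ∎
θ-^S {f} {L} (suc ρ) θf≋fL n = begin
  θ (f ⊛ F) n
    ≡⟨ θ-⊛ f F n ⟩
  (θ f ⊛ F ⊕ f ⊛ θ F) n
    ≡⟨ cong₂ _+_ (⊛-congʳ F θf≋fL n) (⊛-congˡ f (θ-^S ρ θf≋fL) n) ⟩
  ((f ⊛ L) ⊛ F ⊕ f ⊛ (⟨ ρ ⟩ ⊛ (F ⊛ L))) n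
    ≡⟨ series-solve 4 (λ f L F r → (f :⊛ L) :⊛ F :⊕ f :⊛ (r :⊛ (F :⊛ L))
                                 :≋ (:⟨ 1 ⟩ :⊕ r) :⊛ ((f :⊛ F) :⊛ L))
         ≋-refl f L F ⟨ ρ ⟩ n ⟩
  ((⟨ 1 ⟩ ⊕ ⟨ ρ ⟩) ⊛ ((f ⊛ F) ⊛ L)) n
    ≡⟨ ⊛-congʳ ((f ⊛ F) ⊛ L) (⟨suc⟩ ρ) n ⟨
  (⟨ suc ρ ⟩ ⊛ ((f ⊛ F) ⊛ L)) n ∎
  where F = f ^S ρ

θ≋𝟘⇒≋constant : ∀ f → θ f ≋ 𝟘 → f ≋ constant (f 0)
θ≋𝟘⇒≋constant f θf≋𝟘 zero    = refl
θ≋𝟘⇒≋constant f θf≋𝟘 (suc n) =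
  *-cancelˡ-≢0 (fromℕ (suc n)) (fromℕ≢0 (suc n)) (trans (θf≋𝟘 (suc n)) (sym (ℚ.*-zeroʳ (fromℕ (suc n)))))

X : Series
X 1 = 1ℚ
X _ = 0ℚ

X-⊛-suc : ∀ f n → (X ⊛ f) (suc n) ≡ f n
X-⊛-suc f n = begin
  (X ⊛ f) (suc n)               ≡⟨ ⊛-suc X f n ⟩
  0ℚ * f (suc n) + (tail X ⊛ f) n ≡⟨ cong₂ _+_ (ℚ.*-zeroˡ (f (suc n))) (⊛-congʳ f tail-X n) ⟩
  0ℚ + (one ⊛ f) n              ≡⟨ ℚ.+-identityˡ _ ⟩
  (one ⊛ f) n                   ≡⟨ ⊛-identityˡ f n ⟩
  f n                           ∎
  where
  tail-X : tail X ≋ one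
  tail-X zero    = refl
  tail-X (suc n) = refl

θ-X : θ X ≋ X
θ-X 0             = refl
θ-X 1             = refl
θ-X (suc (suc n)) = ℚ.*-zeroʳ (fromℕ (suc (suc n)))

-- sin z / z and its reciprocal

sinc-recurrence : ∀ m → fromℕ (2 ℕ.+ 2 ℕ.* m) * fromℕ (3 ℕ.+ 2 ℕ.* m) * sinc (suc m) ≡ - sinc m
sinc-recurrence m = begin
  fromℕ (1 ℕ.+ n) * fromℕ (2 ℕ.+ n) * (- 1ℚ * s * 1/ (1 ℕ.+ 2 ℕ.* suc m) !)
    ≡⟨ cong (λ k → fromℕ (1 ℕ.+ n) * fromℕ (2 ℕ.+ n) * (- 1ℚ * s * 1/ suc k !)) (ℕ.*-suc 2 m) ⟩
  fromℕ (1 ℕ.+ n) * fromℕ (2 ℕ.+ n) * (- 1ℚ * s * 1/ (2 ℕ.+ n) !)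
    ≡⟨ solve 4 (λ a b s u → a :* b :* (:- con 1ℚ :* s :* u) := :- (s :* (u :* (a :* b))))
         refl (fromℕ (1 ℕ.+ n)) (fromℕ (2 ℕ.+ n)) s (1/ (2 ℕ.+ n) !) ⟩
  - (s * (1/ (2 ℕ.+ n) ! * (fromℕ (1 ℕ.+ n) * fromℕ (2 ℕ.+ n))))
    ≡⟨ cong (λ u → - (s * u)) (1/[2+n]!*[1+n]*[2+n]≡1/n! n) ⟩
  - sinc m ∎
  where
  n = 1 ℕ.+ 2 ℕ.* m
  s = (- 1ℚ) ^ℚ m

sinc-ode : ⟨ 4 ⟩ ⊛ θ (θ sinc) ≋ ⊖ (⟨ 2 ⟩ ⊛ θ sinc ⊕ X ⊛ sinc)
sinc-ode zero    = refl
sinc-ode (suc m) = begin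
  (⟨ 4 ⟩ ⊛ θ (θ sinc)) (suc m)
    ≡⟨ constant-⊛ (fromℕ 4) (θ (θ sinc)) (suc m) ⟩
  fromℕ 4 * (fromℕ (suc m) * (fromℕ (suc m) * s′))
    ≡⟨ cong (λ k → fromℕ 4 * (k * (k * s′))) (fromℕ-suc m) ⟩
  fromℕ 4 * ((1ℚ + M) * ((1ℚ + M) * s′))
    ≡⟨ solve 2 (λ M s′ → con (fromℕ 4) :* ((con 1ℚ :+ M) :* ((con 1ℚ :+ M) :* s′))
                      := (con (fromℕ 2) :+ con (fromℕ 2) :* M) :* (con (fromℕ 3) :+ con (fromℕ 2) :* M) :* s′
                         :- con (fromℕ 2) :* ((con 1ℚ :+ M) :* s′))
         refl M s′ ⟩
  (fromℕ 2 + fromℕ 2 * M) * (fromℕ 3 + fromℕ 2 * M) * s′ - fromℕ 2 * ((1ℚ + M) * s′)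
    ≡⟨ cong₂ (λ a b → a * b * s′ - fromℕ 2 * ((1ℚ + M) * s′)) (fromℕ-affine 2 2 m) (fromℕ-affine 3 2 m) ⟨
  fromℕ (2 ℕ.+ 2 ℕ.* m) * fromℕ (3 ℕ.+ 2 ℕ.* m) * s′ - fromℕ 2 * ((1ℚ + M) * s′)
    ≡⟨ cong (_- fromℕ 2 * ((1ℚ + M) * s′)) (sinc-recurrence m) ⟩
  - sinc m - fromℕ 2 * ((1ℚ + M) * s′)
    ≡⟨ solve 2 (λ a b → :- b :- a := :- (a :+ b)) refl (fromℕ 2 * ((1ℚ + M) * s′)) (sinc m) ⟩
  - (fromℕ 2 * ((1ℚ + M) * s′) + sinc m)
    ≡⟨ cong₂ (λ a b → - (fromℕ 2 * (a * s′) + b)) (fromℕ-suc m) (X-⊛-suc sinc m) ⟨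
  - (fromℕ 2 * (fromℕ (suc m) * s′) + (X ⊛ sinc) (suc m))
    ≡⟨ cong (λ a → - (a + (X ⊛ sinc) (suc m))) (constant-⊛ (fromℕ 2) (θ sinc) (suc m)) ⟨
  (⊖ (⟨ 2 ⟩ ⊛ θ sinc ⊕ X ⊛ sinc)) (suc m) ∎
  where
  M  = fromℕ m
  s′ = sinc (suc m)

cosine : Series
cosine = sinc ⊕ ⟨ 2 ⟩ ⊛ θ sinc

sinc-pythagoras : cosine ⊛ cosine ⊕ X ⊛ (sinc ⊛ sinc) ≋ ⟨ 1 ⟩
sinc-pythagoras = θ≋𝟘⇒≋constant E θE≋𝟘
  where
  S = sinc
  A = θ sinc
  B = θ (θ sinc)
  C = cosine
  E = cosine ⊛ cosine ⊕ X ⊛ (sinc ⊛ sinc)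

  θC : θ C ≋ A ⊕ ⟨ 2 ⟩ ⊛ B
  θC n = trans (θ-⊕ S (⟨ 2 ⟩ ⊛ A) n) (cong (A n +_) (θ-constant-⊛ (fromℕ 2) A n))

  θE≋𝟘 : θ E ≋ 𝟘
  θE≋𝟘 n = begin
    θ E n
      ≡⟨ θ-⊕ (C ⊛ C) (X ⊛ (S ⊛ S)) n ⟩
    (θ (C ⊛ C) ⊕ θ (X ⊛ (S ⊛ S))) n
      ≡⟨ cong₂ _+_ (θ-⊛ C C n) (θ-⊛ X (S ⊛ S) n) ⟩
    (θ C ⊛ C ⊕ C ⊛ θ C ⊕ (θ X ⊛ (S ⊛ S) ⊕ X ⊛ θ (S ⊛ S))) n
      ≡⟨ cong₂ _+_ (cong₂ _+_ (⊛-congʳ C θC n) (⊛-congˡ C θC n))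
                   (cong₂ _+_ (⊛-congʳ (S ⊛ S) θ-X n) (⊛-congˡ X (θ-⊛ S S) n)) ⟩
    ((A ⊕ ⟨ 2 ⟩ ⊛ B) ⊛ C ⊕ C ⊛ (A ⊕ ⟨ 2 ⟩ ⊛ B) ⊕ (X ⊛ (S ⊛ S) ⊕ X ⊛ (θ S ⊛ S ⊕ S ⊛ θ S))) n
      ≡⟨ series-solve 4 (λ s a b x →
           (a :⊕ :⟨ 2 ⟩ :⊛ b) :⊛ (s :⊕ :⟨ 2 ⟩ :⊛ a) :⊕ (s :⊕ :⟨ 2 ⟩ :⊛ a) :⊛ (a :⊕ :⟨ 2 ⟩ :⊛ b)
             :⊕ (x :⊛ (s :⊛ s) :⊕ x :⊛ (a :⊛ s :⊕ s :⊛ a))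
           :≋ (s :⊕ :⟨ 2 ⟩ :⊛ a) :⊛ (:⟨ 4 ⟩ :⊛ b :⊕ (:⟨ 2 ⟩ :⊛ a :⊕ x :⊛ s))) ≋-refl S A B X n ⟩
    (C ⊛ (⟨ 4 ⟩ ⊛ B ⊕ (⟨ 2 ⟩ ⊛ A ⊕ X ⊛ S))) n
      ≡⟨ ⊛-congˡ C (⊕-congʳ (⟨ 2 ⟩ ⊛ A ⊕ X ⊛ S) sinc-ode) n ⟩
    (C ⊛ (⊖ (⟨ 2 ⟩ ⊛ A ⊕ X ⊛ S) ⊕ (⟨ 2 ⟩ ⊛ A ⊕ X ⊛ S))) n
      ≡⟨ series-solve 3 (λ s a x →
           (s :⊕ :⟨ 2 ⟩ :⊛ a) :⊛ (:⊖ (:⟨ 2 ⟩ :⊛ a :⊕ x :⊛ s) :⊕ (:⟨ 2 ⟩ :⊛ a :⊕ x :⊛ s)) :≋ :⟨ 0 ⟩)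
           ≋-refl S A X n ⟩
    ⟨ 0 ⟩ n
      ≡⟨ constant-0 n ⟩
    0ℚ ∎

invSincRev≡applyUpTo : ∀ n → invSincRev n ≡ applyUpTo (λ i → invSinc (n ∸ i)) (suc n)
invSincRev≡applyUpTo zero    = refl
invSincRev≡applyUpTo (suc n) = cong (invSinc (suc n) ∷_) (invSincRev≡applyUpTo n)

invSinc-suc : ∀ n → invSinc (suc n) ≡ - (tail sinc ⊛ invSinc) n
invSinc-suc n = cong -_ (begin
  sumℚ (zipWith _*_ (map (sinc ∘ suc) (upTo (suc n))) (invSincRev n))
    ≡⟨ cong₂ (λ xs ys → sumℚ (zipWith _*_ xs ys)) (map-upTo (sinc ∘ suc) (suc n)) (invSincRev≡applyUpTo n) ⟩
  sumℚ (zipWith _*_ (applyUpTo (sinc ∘ suc) (suc n)) (applyUpTo (λ i → invSinc (n ∸ i)) (suc n)))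
    ≡⟨ cong sumℚ (zipWith-applyUpTo _*_ (sinc ∘ suc) (λ i → invSinc (n ∸ i)) (suc n)) ⟩
  sumℚ (applyUpTo (λ i → sinc (suc i) * invSinc (n ∸ i)) (suc n))
    ≡⟨ cong sumℚ (map-upTo (λ i → sinc (suc i) * invSinc (n ∸ i)) (suc n)) ⟨
  (tail sinc ⊛ invSinc) n ∎)

invSinc⊛sinc : invSinc ⊛ sinc ≋ ⟨ 1 ⟩
invSinc⊛sinc = ≋-trans (⊛-comm invSinc sinc) sinc⊛invSinc
  where
  sinc⊛invSinc : sinc ⊛ invSinc ≋ ⟨ 1 ⟩
  sinc⊛invSinc zero    = refl
  sinc⊛invSinc (suc n) = begin
    (sinc ⊛ invSinc) (suc n)                             ≡⟨ ⊛-suc sinc invSinc n ⟩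
    1ℚ * invSinc (suc n) + (tail sinc ⊛ invSinc) n
      ≡⟨ cong (λ y → 1ℚ * y + (tail sinc ⊛ invSinc) n) (invSinc-suc n) ⟩
    1ℚ * - (tail sinc ⊛ invSinc) n + (tail sinc ⊛ invSinc) n
      ≡⟨ solve 1 (λ y → con 1ℚ :* (:- y) :+ y := con 0ℚ) refl ((tail sinc ⊛ invSinc) n) ⟩
    0ℚ ∎

T : Series
T = invSinc ⊛ θ sinc

θ-invSinc : θ invSinc ≋ invSinc ⊛ ⊖ T
θ-invSinc n = begin
  θ g n
    ≡⟨ series-solve 1 (λ P → P :≋ P :⊛ :⟨ 1 ⟩) ≋-refl (θ g) n ⟩
  (θ g ⊛ ⟨ 1 ⟩) n
    ≡⟨ ⊛-congˡ (θ g) (≋-sym invSinc⊛sinc) n ⟩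
  (θ g ⊛ (g ⊛ S)) n
    ≡⟨ series-solve 4 (λ P g S A → P :⊛ (g :⊛ S) :≋ (P :⊛ S :⊕ g :⊛ A) :⊛ g :⊕ g :⊛ :⊖ (g :⊛ A))
         ≋-refl (θ g) g S (θ S) n ⟩
  ((θ g ⊛ S ⊕ g ⊛ θ S) ⊛ g ⊕ g ⊛ ⊖ T) n
    ≡⟨ ⊕-congʳ (g ⊛ ⊖ T) (⊛-congʳ g θ[g⊛S]≋0) n ⟩
  (⟨ 0 ⟩ ⊛ g ⊕ g ⊛ ⊖ T) n
    ≡⟨ series-solve 2 (λ g T → :⟨ 0 ⟩ :⊛ g :⊕ g :⊛ :⊖ T :≋ g :⊛ :⊖ T) ≋-refl g T n ⟩
  (g ⊛ ⊖ T) n ∎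
  where
  g = invSinc
  S = sinc
  θ[g⊛S]≋0 : θ g ⊛ S ⊕ g ⊛ θ S ≋ ⟨ 0 ⟩
  θ[g⊛S]≋0 = ≋-trans (≋-sym (θ-⊛ g S)) (≋-trans (θ-cong invSinc⊛sinc)
               (≋-trans (θ-constant (fromℕ 1)) (≋-sym constant-0)))

θ-T : θ T ≋ ⊖ (T ⊛ T) ⊕ invSinc ⊛ θ (θ sinc)
θ-T n = begin
  θ (g ⊛ A) n                      ≡⟨ θ-⊛ g A n ⟩
  (θ g ⊛ A ⊕ g ⊛ B) n              ≡⟨ ⊕-congʳ (g ⊛ B) (⊛-congʳ A θ-invSinc) n ⟩
  ((g ⊛ ⊖ T) ⊛ A ⊕ g ⊛ B) n
    ≡⟨ series-solve 3 (λ g A B → (g :⊛ :⊖ (g :⊛ A)) :⊛ A :⊕ g :⊛ B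
                               :≋ :⊖ ((g :⊛ A) :⊛ (g :⊛ A)) :⊕ g :⊛ B)
         ≋-refl g A B n ⟩
  (⊖ (T ⊛ T) ⊕ g ⊛ B) n ∎
  where
  g = invSinc
  A = θ sinc
  B = θ (θ sinc)

T-riccati : ⟨ 4 ⟩ ⊛ θ T ≋ ⊖ (⟨ 4 ⟩ ⊛ (T ⊛ T) ⊕ ⟨ 2 ⟩ ⊛ T ⊕ X)
T-riccati n = begin
  (⟨ 4 ⟩ ⊛ θ T) n
    ≡⟨ ⊛-congˡ ⟨ 4 ⟩ θ-T n ⟩
  (⟨ 4 ⟩ ⊛ (⊖ (T ⊛ T) ⊕ g ⊛ B)) n
    ≡⟨ series-solve 3 (λ T g B → :⟨ 4 ⟩ :⊛ (:⊖ (T :⊛ T) :⊕ g :⊛ B)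
                               :≋ :⊖ (:⟨ 4 ⟩ :⊛ (T :⊛ T)) :⊕ g :⊛ (:⟨ 4 ⟩ :⊛ B))
         ≋-refl T g B n ⟩
  (⊖ (⟨ 4 ⟩ ⊛ (T ⊛ T)) ⊕ g ⊛ (⟨ 4 ⟩ ⊛ B)) n
    ≡⟨ ⊕-congˡ (⊖ (⟨ 4 ⟩ ⊛ (T ⊛ T))) (⊛-congˡ g sinc-ode) n ⟩
  (⊖ (⟨ 4 ⟩ ⊛ (T ⊛ T)) ⊕ g ⊛ ⊖ (⟨ 2 ⟩ ⊛ A ⊕ X ⊛ S)) n
    ≡⟨ series-solve 5 (λ g S A B X →
         :⊖ (:⟨ 4 ⟩ :⊛ ((g :⊛ A) :⊛ (g :⊛ A))) :⊕ g :⊛ :⊖ (:⟨ 2 ⟩ :⊛ A :⊕ X :⊛ S)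
         :≋ :⊖ (:⟨ 4 ⟩ :⊛ ((g :⊛ A) :⊛ (g :⊛ A)) :⊕ :⟨ 2 ⟩ :⊛ (g :⊛ A) :⊕ X :⊛ (g :⊛ S)))
         ≋-refl g S A B X n ⟩
  (⊖ (⟨ 4 ⟩ ⊛ (T ⊛ T) ⊕ ⟨ 2 ⟩ ⊛ T ⊕ X ⊛ (g ⊛ S))) n
    ≡⟨ ⊖-cong (⊕-congˡ (⟨ 4 ⟩ ⊛ (T ⊛ T) ⊕ ⟨ 2 ⟩ ⊛ T) (⊛-congˡ X invSinc⊛sinc)) n ⟩
  (⊖ (⟨ 4 ⟩ ⊛ (T ⊛ T) ⊕ ⟨ 2 ⟩ ⊛ T ⊕ X ⊛ ⟨ 1 ⟩)) n
    ≡⟨ series-solve 2 (λ T X → :⊖ (:⟨ 4 ⟩ :⊛ (T :⊛ T) :⊕ :⟨ 2 ⟩ :⊛ T :⊕ X :⊛ :⟨ 1 ⟩)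
                              :≋ :⊖ (:⟨ 4 ⟩ :⊛ (T :⊛ T) :⊕ :⟨ 2 ⟩ :⊛ T :⊕ X)) ≋-refl T X n ⟩
  (⊖ (⟨ 4 ⟩ ⊛ (T ⊛ T) ⊕ ⟨ 2 ⟩ ⊛ T ⊕ X)) n ∎
  where
  g = invSinc
  S = sinc
  A = θ sinc
  B = θ (θ sinc)

invSinc-square : invSinc ⊛ invSinc ≋ (⟨ 1 ⟩ ⊕ ⟨ 2 ⟩ ⊛ T) ⊛ (⟨ 1 ⟩ ⊕ ⟨ 2 ⟩ ⊛ T) ⊕ X
invSinc-square n = begin
  (g ⊛ g) n
    ≡⟨ series-solve 1 (λ g → g :⊛ g :≋ (g :⊛ g) :⊛ :⟨ 1 ⟩) ≋-refl g n ⟩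
  ((g ⊛ g) ⊛ ⟨ 1 ⟩) n
    ≡⟨ ⊛-congˡ (g ⊛ g) sinc-pythagoras n ⟨
  ((g ⊛ g) ⊛ (cosine ⊛ cosine ⊕ X ⊛ (S ⊛ S))) n
    ≡⟨ series-solve 4 (λ g S A X →
         (g :⊛ g) :⊛ ((S :⊕ :⟨ 2 ⟩ :⊛ A) :⊛ (S :⊕ :⟨ 2 ⟩ :⊛ A) :⊕ X :⊛ (S :⊛ S))
         :≋ (g :⊛ S :⊕ :⟨ 2 ⟩ :⊛ (g :⊛ A)) :⊛ (g :⊛ S :⊕ :⟨ 2 ⟩ :⊛ (g :⊛ A)) :⊕ X :⊛ ((g :⊛ S) :⊛ (g :⊛ S)))
         ≋-refl g S (θ S) X n ⟩
  ((g ⊛ S ⊕ ⟨ 2 ⟩ ⊛ T) ⊛ (g ⊛ S ⊕ ⟨ 2 ⟩ ⊛ T) ⊕ X ⊛ ((g ⊛ S) ⊛ (g ⊛ S))) n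
    ≡⟨ cong₂ _+_ (⊛-cong g⊛S⊕2T g⊛S⊕2T n) (⊛-congˡ X (⊛-cong invSinc⊛sinc invSinc⊛sinc) n) ⟩
  ((⟨ 1 ⟩ ⊕ ⟨ 2 ⟩ ⊛ T) ⊛ (⟨ 1 ⟩ ⊕ ⟨ 2 ⟩ ⊛ T) ⊕ X ⊛ (⟨ 1 ⟩ ⊛ ⟨ 1 ⟩)) n
    ≡⟨ series-solve 2 (λ T X → let u = :⟨ 1 ⟩ :⊕ :⟨ 2 ⟩ :⊛ T in u :⊛ u :⊕ X :⊛ (:⟨ 1 ⟩ :⊛ :⟨ 1 ⟩) :≋ u :⊛ u :⊕ X)
         ≋-refl T X n ⟩
  ((⟨ 1 ⟩ ⊕ ⟨ 2 ⟩ ⊛ T) ⊛ (⟨ 1 ⟩ ⊕ ⟨ 2 ⟩ ⊛ T) ⊕ X) n ∎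
  where
  g = invSinc
  S = sinc
  g⊛S⊕2T : g ⊛ S ⊕ ⟨ 2 ⟩ ⊛ T ≋ ⟨ 1 ⟩ ⊕ ⟨ 2 ⟩ ⊛ T
  g⊛S⊕2T = ⊕-congʳ (⟨ 2 ⟩ ⊛ T) invSinc⊛sinc

-- The recurrence in ρ

𝓛 : ℕ → Series → Series
𝓛 ρ F = ⟨ 4 ⟩ ⊛ θ (θ F) ⊕ ⊖ (⟨ 4 ⟩ ⊛ (⟨ ρ ⟩ ⊛ θ F) ⊕ ⟨ 2 ⟩ ⊛ θ F)
          ⊕ ⟨ ρ ⟩ ⊛ (⟨ ρ ⟩ ⊛ F ⊕ F) ⊕ ⟨ ρ ⟩ ⊛ (⟨ ρ ⟩ ⊛ (X ⊛ F))

module _ (ρ : ℕ) where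
  private
    g = invSinc
    G = invSinc ^S ρ
    r = ⟨ ρ ⟩

  θ-invSinc^S : θ G ≋ r ⊛ (G ⊛ ⊖ T)
  θ-invSinc^S = θ-^S ρ θ-invSinc

  θθ-invSinc^S : θ (θ G) ≋ r ⊛ (θ G ⊛ ⊖ T ⊕ G ⊛ ⊖ θ T)
  θθ-invSinc^S n = begin
    θ (θ G) n                              ≡⟨ θ-cong θ-invSinc^S n ⟩
    θ (r ⊛ (G ⊛ ⊖ T)) n                    ≡⟨ θ-constant-⊛ (fromℕ ρ) (G ⊛ ⊖ T) n ⟩
    (r ⊛ θ (G ⊛ ⊖ T)) n                    ≡⟨ ⊛-congˡ r (≋-trans (θ-⊛ G (⊖ T))
                                                              (⊕-congˡ (θ G ⊛ ⊖ T) (⊛-congˡ G (θ-⊖ T)))) n ⟩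
    (r ⊛ (θ G ⊛ ⊖ T ⊕ G ⊛ ⊖ θ T)) n        ∎

  𝓛-invSinc^S : 𝓛 ρ G ≋ r ⊛ ((r ⊕ ⟨ 1 ⟩) ⊛ (((⟨ 1 ⟩ ⊕ ⟨ 2 ⟩ ⊛ T) ⊛ (⟨ 1 ⟩ ⊕ ⟨ 2 ⟩ ⊛ T) ⊕ X) ⊛ G))
  𝓛-invSinc^S n = begin
    (⟨ 4 ⟩ ⊛ θ (θ G) ⊕ θG-terms ⊕ G-terms ⊕ XG-terms) n
      ≡⟨ cong (λ q → q + θG-terms n + G-terms n + XG-terms n) (⊛-congˡ ⟨ 4 ⟩ θθ-invSinc^S n) ⟩
    (⟨ 4 ⟩ ⊛ (r ⊛ (θ G ⊛ ⊖ T ⊕ G ⊛ ⊖ θ T)) ⊕ θG-terms ⊕ G-terms ⊕ XG-terms) n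
      ≡⟨ series-solve 6 (λ r G P T U X →
           :⟨ 4 ⟩ :⊛ (r :⊛ (P :⊛ :⊖ T :⊕ G :⊛ :⊖ U)) :⊕ :⊖ (:⟨ 4 ⟩ :⊛ (r :⊛ P) :⊕ :⟨ 2 ⟩ :⊛ P)
             :⊕ r :⊛ (r :⊛ G :⊕ G) :⊕ r :⊛ (r :⊛ (X :⊛ G))
           :≋ r :⊛ (r :⊛ G :⊕ G) :⊕ r :⊛ (r :⊛ (X :⊛ G))
             :⊕ (:⊖ ((:⟨ 4 ⟩ :⊛ (r :⊛ T) :⊕ :⟨ 4 ⟩ :⊛ r :⊕ :⟨ 2 ⟩) :⊛ P)
                 :⊕ :⊖ (r :⊛ (G :⊛ (:⟨ 4 ⟩ :⊛ U)))))
         ≋-refl r G (θ G) T (θ T) X n ⟩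
    (G-terms ⊕ XG-terms ⊕ (⊖ (Z ⊛ θ G) ⊕ ⊖ (r ⊛ (G ⊛ (⟨ 4 ⟩ ⊛ θ T))))) n
      ≡⟨ ⊕-congˡ (G-terms ⊕ XG-terms)
           (λ k → cong₂ _+_ (⊖-cong (⊛-congˡ Z θ-invSinc^S) k) (⊖-cong (⊛-congˡ r (⊛-congˡ G T-riccati)) k)) n ⟩
    (G-terms ⊕ XG-terms
      ⊕ (⊖ (Z ⊛ (r ⊛ (G ⊛ ⊖ T))) ⊕ ⊖ (r ⊛ (G ⊛ ⊖ (⟨ 4 ⟩ ⊛ (T ⊛ T) ⊕ ⟨ 2 ⟩ ⊛ T ⊕ X))))) n
      ≡⟨ series-solve 4 (λ r G T X →
           r :⊛ (r :⊛ G :⊕ G) :⊕ r :⊛ (r :⊛ (X :⊛ G))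
             :⊕ (:⊖ ((:⟨ 4 ⟩ :⊛ (r :⊛ T) :⊕ :⟨ 4 ⟩ :⊛ r :⊕ :⟨ 2 ⟩) :⊛ (r :⊛ (G :⊛ :⊖ T)))
                 :⊕ :⊖ (r :⊛ (G :⊛ :⊖ (:⟨ 4 ⟩ :⊛ (T :⊛ T) :⊕ :⟨ 2 ⟩ :⊛ T :⊕ X))))
           :≋ r :⊛ ((r :⊕ :⟨ 1 ⟩) :⊛ (((:⟨ 1 ⟩ :⊕ :⟨ 2 ⟩ :⊛ T) :⊛ (:⟨ 1 ⟩ :⊕ :⟨ 2 ⟩ :⊛ T) :⊕ X) :⊛ G)))
         ≋-refl r G T X n ⟩
    (r ⊛ ((r ⊕ ⟨ 1 ⟩) ⊛ (((⟨ 1 ⟩ ⊕ ⟨ 2 ⟩ ⊛ T) ⊛ (⟨ 1 ⟩ ⊕ ⟨ 2 ⟩ ⊛ T) ⊕ X) ⊛ G))) n ∎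
    where
    θG-terms = ⊖ (⟨ 4 ⟩ ⊛ (r ⊛ θ G) ⊕ ⟨ 2 ⟩ ⊛ θ G)
    G-terms  = r ⊛ (r ⊛ G ⊕ G)
    XG-terms = r ⊛ (r ⊛ (X ⊛ G))
    Z        = ⟨ 4 ⟩ ⊛ (r ⊛ T) ⊕ ⟨ 4 ⟩ ⊛ r ⊕ ⟨ 2 ⟩

  invSinc^S-recurrence : r ⊛ (r ⊛ (g ^S (2 ℕ.+ ρ)) ⊕ g ^S (2 ℕ.+ ρ)) ≋ 𝓛 ρ G
  invSinc^S-recurrence = ≋-sym λ n → begin
    𝓛 ρ G n
      ≡⟨ 𝓛-invSinc^S n ⟩
    (r ⊛ ((r ⊕ ⟨ 1 ⟩) ⊛ (((⟨ 1 ⟩ ⊕ ⟨ 2 ⟩ ⊛ T) ⊛ (⟨ 1 ⟩ ⊕ ⟨ 2 ⟩ ⊛ T) ⊕ X) ⊛ G))) n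
      ≡⟨ ⊛-congˡ r (⊛-congˡ (r ⊕ ⟨ 1 ⟩) (⊛-congʳ G invSinc-square)) n ⟨
    (r ⊛ ((r ⊕ ⟨ 1 ⟩) ⊛ ((g ⊛ g) ⊛ G))) n
      ≡⟨ series-solve 3 (λ r g G → r :⊛ ((r :⊕ :⟨ 1 ⟩) :⊛ ((g :⊛ g) :⊛ G))
                                 :≋ r :⊛ (r :⊛ (g :⊛ (g :⊛ G)) :⊕ g :⊛ (g :⊛ G)))
         ≋-refl r g G n ⟩
    (r ⊛ (r ⊛ (g ^S (2 ℕ.+ ρ)) ⊕ g ^S (2 ℕ.+ ρ))) n ∎

c-recurrence : ∀ ρ k → let R = fromℕ ρ ; K = fromℕ k in
  R * (R + 1ℚ) * c (2 ℕ.+ ρ) k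
    ≡ (fromℕ 2 * K - R) * (fromℕ 2 * K - R - 1ℚ) * c ρ k + R * R * (X ⊛ (invSinc ^S ρ)) k
c-recurrence ρ k = begin
  R * (R + 1ℚ) * c₂ k
    ≡⟨ solve 2 (λ R y → R :* (R :+ con 1ℚ) :* y := R :* (R :* y :+ y)) refl R (c₂ k) ⟩
  R * (R * c₂ k + c₂ k)
    ≡⟨ trans (constant-⊛ R (r ⊛ c₂ ⊕ c₂) k) (cong (λ y → R * (y + c₂ k)) (constant-⊛ R c₂ k)) ⟨
  (r ⊛ (r ⊛ c₂ ⊕ c₂)) k
    ≡⟨ invSinc^S-recurrence ρ k ⟩
  𝓛 ρ G k
    ≡⟨ cong₂ _+_ (cong₂ _+_ (cong₂ _+_ θθG-term θG-term) G-term) XG-term ⟩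
  fromℕ 4 * (K * (K * c ρ k)) + - (fromℕ 4 * (R * (K * c ρ k)) + fromℕ 2 * (K * c ρ k))
    + R * (R * c ρ k + c ρ k) + R * (R * (X ⊛ G) k)
    ≡⟨ solve 4 (λ R K y d →
         con (fromℕ 4) :* (K :* (K :* y)) :+ :- (con (fromℕ 4) :* (R :* (K :* y)) :+ con (fromℕ 2) :* (K :* y))
           :+ R :* (R :* y :+ y) :+ R :* (R :* d)
         := (con (fromℕ 2) :* K :- R) :* (con (fromℕ 2) :* K :- R :- con 1ℚ) :* y :+ R :* R :* d)
       refl R K (c ρ k) ((X ⊛ G) k) ⟩
  (fromℕ 2 * K - R) * (fromℕ 2 * K - R - 1ℚ) * c ρ k + R * R * (X ⊛ G) k ∎
  where
  R = fromℕ ρ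
  K = fromℕ k
  r = ⟨ ρ ⟩
  G = invSinc ^S ρ
  c₂ = invSinc ^S (2 ℕ.+ ρ)
  θθG-term = constant-⊛ (fromℕ 4) (θ (θ G)) k
  θG-term = cong -_ (cong₂ _+_
    (trans (constant-⊛ (fromℕ 4) (r ⊛ θ G) k) (cong (fromℕ 4 *_) (constant-⊛ R (θ G) k)))
    (constant-⊛ (fromℕ 2) (θ G) k))
  G-term = trans (constant-⊛ R (r ⊛ G ⊕ G) k) (cong (λ y → R * (y + c ρ k)) (constant-⊛ R G k))
  XG-term = trans (constant-⊛ R (r ⊛ (X ⊛ G)) k) (cong (R *_) (constant-⊛ R (X ⊛ G) k))

-- Central coefficients

X-⊛-zero : ∀ f → (X ⊛ f) 0 ≡ 0ℚ
X-⊛-zero f = trans (⊛-head X f) (ℚ.*-zeroˡ (f 0))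

-- central n m = c (2n) (n − m), read as 0 when m > n.
central : ℕ → ℕ → ℚ
central n m = (X ⊛ (invSinc ^S (2 ℕ.* n))) (suc n ∸ m)

central≡c : ∀ {n m} → m ≤ n → central n m ≡ c (2 ℕ.* n) (n ∸ m)
central≡c {n} {m} m≤n =
  trans (cong (X ⊛ (invSinc ^S (2 ℕ.* n))) (ℕ.+-∸-assoc 1 m≤n)) (X-⊛-suc (invSinc ^S (2 ℕ.* n)) (n ∸ m))

central-vanishes : ∀ {n m} → n < m → central n m ≡ 0ℚ
central-vanishes {n} {m} n<m =
  trans (cong (X ⊛ (invSinc ^S (2 ℕ.* n))) (ℕ.m≤n⇒m∸n≡0 n<m)) (X-⊛-zero (invSinc ^S (2 ℕ.* n)))

ψ : ℕ → ℚ
ψ n = fromℕ (2 ℕ.* n) * (fromℕ (2 ℕ.* n) + 1ℚ)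

central-recurrence : ∀ n m →
  ψ n * central (suc n) (suc m) ≡ ψ m * central n m + fromℕ (2 ℕ.* n) * fromℕ (2 ℕ.* n) * central n (suc m)
central-recurrence n m with ℕ.≤-<-connex m n
... | inj₂ n<m = begin
  ψ n * central (suc n) (suc m)
    ≡⟨ cong (ψ n *_) (central-vanishes (s≤s n<m)) ⟩
  ψ n * 0ℚ
    ≡⟨ solve 3 (λ a b c → a :* con 0ℚ := b :* con 0ℚ :+ c :* con 0ℚ) refl (ψ n) (ψ m) (R * R) ⟩
  ψ m * 0ℚ + R * R * 0ℚ
    ≡⟨ cong₂ (λ x y → ψ m * x + R * R * y) (central-vanishes n<m) (central-vanishes (ℕ.m<n⇒m<1+n n<m)) ⟨
  ψ m * central n m + R * R * central n (suc m) ∎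
  where R = fromℕ (2 ℕ.* n)
... | inj₁ m≤n = begin
  ψ n * central (suc n) (suc m)
    ≡⟨ cong (ψ n *_) (trans (central≡c (s≤s m≤n)) (cong (λ ρ → c ρ k) (ℕ.*-suc 2 n))) ⟩
  ψ n * c (2 ℕ.+ 2 ℕ.* n) k
    ≡⟨ c-recurrence (2 ℕ.* n) k ⟩
  (fromℕ 2 * K - R) * (fromℕ 2 * K - R - 1ℚ) * c (2 ℕ.* n) k + R * R * central n (suc m)
    ≡⟨ cong₂ (λ a b → a * b + R * R * central n (suc m)) ψ-shift (central≡c m≤n) ⟨
  ψ m * central n m + R * R * central n (suc m) ∎
  where
  k = n ∸ m
  K = fromℕ k
  M = fromℕ m
  R = fromℕ (2 ℕ.* n)
  R≡2[K+M] : R ≡ fromℕ 2 * (K + M)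
  R≡2[K+M] = trans (cong (λ t → fromℕ (2 ℕ.* t)) (sym (ℕ.m∸n+n≡m m≤n)))
                   (trans (fromℕ-* 2 (k ℕ.+ m)) (cong (fromℕ 2 *_) (fromℕ-+ k m)))
  ψ-shift : ψ m ≡ (fromℕ 2 * K - R) * (fromℕ 2 * K - R - 1ℚ)
  ψ-shift = begin
    fromℕ (2 ℕ.* m) * (fromℕ (2 ℕ.* m) + 1ℚ)
      ≡⟨ cong (λ t → t * (t + 1ℚ)) (fromℕ-* 2 m) ⟩
    fromℕ 2 * M * (fromℕ 2 * M + 1ℚ)
      ≡⟨ solve 2 (λ K M → con (fromℕ 2) :* M :* (con (fromℕ 2) :* M :+ con 1ℚ)
                       := (con (fromℕ 2) :* K :- con (fromℕ 2) :* (K :+ M))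
                          :* (con (fromℕ 2) :* K :- con (fromℕ 2) :* (K :+ M) :- con 1ℚ)) refl K M ⟩
    (fromℕ 2 * K - fromℕ 2 * (K + M)) * (fromℕ 2 * K - fromℕ 2 * (K + M) - 1ℚ)
      ≡⟨ cong (λ t → (fromℕ 2 * K - t) * (fromℕ 2 * K - t - 1ℚ)) R≡2[K+M] ⟨
    (fromℕ 2 * K - R) * (fromℕ 2 * K - R - 1ℚ) ∎

central-recurrence₀ : ∀ n → ψ n * central (suc n) 1 ≡ fromℕ (2 ℕ.* n) * fromℕ (2 ℕ.* n) * central n 1
central-recurrence₀ n = trans (central-recurrence n 0)
  (solve 2 (λ a b → con 0ℚ :* a :+ b := b) refl (central n 0) (fromℕ (2 ℕ.* n) * fromℕ (2 ℕ.* n) * central n 1))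

ψ-suc≢0 : ∀ n → ψ (suc n) ≢ 0ℚ
ψ-suc≢0 n = *-≢0 (fromℕ≢0 (2 ℕ.* suc n))
  (λ eq → fromℕ≢0 (suc (2 ℕ.* suc n)) (trans (fromℕ-suc (2 ℕ.* suc n)) (trans (ℚ.+-comm 1ℚ R) eq)))
  where R = fromℕ (2 ℕ.* suc n)

central-1≢0 : ∀ p → central (suc p) 1 ≢ 0ℚ
central-1≢0 zero    ()
central-1≢0 (suc p) eq = central-1≢0 p (*-cancelˡ-≢0 (R * R) (*-≢0 R≢0 R≢0) (begin
  R * R * central (suc p) 1      ≡⟨ central-recurrence₀ (suc p) ⟨
  ψ (suc p) * central (suc (suc p)) 1 ≡⟨ cong (ψ (suc p) *_) eq ⟩
  ψ (suc p) * 0ℚ                 ≡⟨ ℚ.*-zeroʳ (ψ (suc p)) ⟩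
  0ℚ                             ≡⟨ ℚ.*-zeroʳ (R * R) ⟨
  R * R * 0ℚ                     ∎))
  where
  R = fromℕ (2 ℕ.* suc p)
  R≢0 = fromℕ≢0 (2 ℕ.* suc p)

elementary : (ℕ → ℚ) → ℕ → ℕ → ℚ
elementary x zero    p       = 1ℚ
elementary x (suc j) zero    = 0ℚ
elementary x (suc j) (suc p) = elementary x (suc j) p + x (suc p) * elementary x j p

inverseSquare : ℕ → ℚ
inverseSquare k = 1ℚ ⊘ (fromℕ k * fromℕ k)

-- K j = (2j+1)! / 4^j
K : ℕ → ℚ
K zero    = 1ℚ
K (suc j) = (ψ (suc j) * K j) ⊘ fromℕ 4

K-suc : ∀ j → K (suc j) * fromℕ 4 ≡ ψ (suc j) * K j
K-suc j = ⊘-*-cancel (ψ (suc j) * K j) (fromℕ≢0 4)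

square*inverseSquare : ∀ n → fromℕ (suc n) * fromℕ (suc n) * inverseSquare (suc n) ≡ 1ℚ
square*inverseSquare n =
  trans (ℚ.*-comm _ (inverseSquare (suc n))) (⊘-*-cancel 1ℚ (*-≢0 (fromℕ≢0 (suc n)) (fromℕ≢0 (suc n))))

central-closed-form : ∀ p j → central (suc p) (suc j) ≡ K j * elementary inverseSquare j p * central (suc p) 1
central-closed-form p       zero    = sym (ℚ.*-identityˡ (central (suc p) 1))
-- Through the solver rather than cong, so that the closed term central 1 1 is never normalised.
central-closed-form zero    (suc j) =
  trans (central-vanishes {1} {suc (suc j)} (s≤s (s≤s z≤n)))
        (solve 2 (λ k b → con 0ℚ := k :* con 0ℚ :* b) refl (K (suc j)) (central 1 1))
central-closed-form (suc p) (suc j) = *-cancelˡ-≢0 (ψ n) (ψ-suc≢0 p) (begin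
  ψ n * central (suc n) (suc (suc j))
    ≡⟨ central-recurrence n (suc j) ⟩
  ψ (suc j) * central n (suc j) + R * R * central n (suc (suc j))
    ≡⟨ cong₂ (λ a b → ψ (suc j) * a + R * R * b) (central-closed-form p j) (central-closed-form p (suc j)) ⟩
  ψ (suc j) * (K j * e j * b) + R * R * (K (suc j) * e (suc j) * b)
    ≡⟨ solve 5 (λ a k y b z → a :* (k :* y :* b) :+ z := a :* k :* y :* b :+ z)
         refl (ψ (suc j)) (K j) (e j) b (R * R * (K (suc j) * e (suc j) * b)) ⟩
  ψ (suc j) * K j * e j * b + R * R * (K (suc j) * e (suc j) * b)
    ≡⟨ cong (λ a → a * e j * b + R * R * (K (suc j) * e (suc j) * b)) (K-suc j) ⟨
  K (suc j) * fromℕ 4 * e j * b + R * R * (K (suc j) * e (suc j) * b)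
    ≡⟨ cong (λ a → K (suc j) * a * e j * b + R * R * (K (suc j) * e (suc j) * b)) R²x≡4 ⟨
  K (suc j) * (R * R * x) * e j * b + R * R * (K (suc j) * e (suc j) * b)
    ≡⟨ solve 6 (λ k R x y y′ b → k :* (R :* R :* x) :* y :* b :+ R :* R :* (k :* y′ :* b)
                             := k :* (y′ :+ x :* y) :* (R :* R :* b))
         refl (K (suc j)) R x (e j) (e (suc j)) b ⟩
  K (suc j) * (e (suc j) + x * e j) * (R * R * b)
    ≡⟨ cong (K (suc j) * (e (suc j) + x * e j) *_) (central-recurrence₀ n) ⟨
  K (suc j) * (e (suc j) + x * e j) * (ψ n * central (suc n) 1)
    ≡⟨ solve 3 (λ a p b → a :* (p :* b) := p :* (a :* b))
         refl (K (suc j) * (e (suc j) + x * e j)) (ψ n) (central (suc n) 1) ⟩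
  ψ n * (K (suc j) * (e (suc j) + x * e j) * central (suc n) 1) ∎)
  where
  n = suc p
  R = fromℕ (2 ℕ.* n)
  x = inverseSquare n
  b = central n 1
  e : ℕ → ℚ
  e j = elementary inverseSquare j p
  R²x≡4 : R * R * x ≡ fromℕ 4
  R²x≡4 = begin
    R * R * x                              ≡⟨ cong (λ t → t * t * x) (fromℕ-* 2 n) ⟩
    fromℕ 2 * N * (fromℕ 2 * N) * x        ≡⟨ solve 2 (λ N x → con (fromℕ 2) :* N :* (con (fromℕ 2) :* N) :* x
                                                          := con (fromℕ 4) :* (N :* N :* x)) refl N x ⟩
    fromℕ 4 * (N * N * x)                  ≡⟨ cong (fromℕ 4 *_) (square*inverseSquare p) ⟩
    fromℕ 4 * 1ℚ                           ≡⟨ ℚ.*-identityʳ (fromℕ 4) ⟩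
    fromℕ 4                                ∎
    where N = fromℕ n

c-ratio : ∀ p j → j ≤ p → c (2 ℕ.* suc p) (p ∸ j) ⊘ c (2 ℕ.* suc p) p ≡ K j * elementary inverseSquare j p
c-ratio p j j≤p = ⊘-unique (λ eq → central-1≢0 p (trans b≡c eq)) (begin
  K j * elementary inverseSquare j p * c (2 ℕ.* suc p) p
    ≡⟨ cong (K j * elementary inverseSquare j p *_) b≡c ⟨
  K j * elementary inverseSquare j p * central (suc p) 1
    ≡⟨ central-closed-form p j ⟨
  central (suc p) (suc j)
    ≡⟨ central≡c (s≤s j≤p) ⟩
  c (2 ℕ.* suc p) (p ∸ j) ∎)
  where
  b≡c : central (suc p) 1 ≡ c (2 ℕ.* suc p) p
  b≡c = central≡c {suc p} {1} (s≤s z≤n)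

-- Newton's identity

newton₄ : ℚ → ℚ → ℚ → ℚ → ℚ
newton₄ e₁ e₂ e₃ e₄ =
  e₁ * e₁ * e₁ * e₁ - fromℕ 4 * e₁ * e₁ * e₂ + fromℕ 2 * e₂ * e₂ + fromℕ 4 * e₁ * e₃ - fromℕ 4 * e₄

Σ^4≡newton₄ : ∀ x p → Σ< p (λ i → x (suc i) ^ℚ 4)
                      ≡ newton₄ (elementary x 1 p) (elementary x 2 p) (elementary x 3 p) (elementary x 4 p)
Σ^4≡newton₄ x zero    = refl
Σ^4≡newton₄ x (suc p) = begin
  Σ< (suc p) (λ i → x (suc i) ^ℚ 4)
    ≡⟨ Σ<-snoc p (λ i → x (suc i) ^ℚ 4) ⟩
  Σ< p (λ i → x (suc i) ^ℚ 4) + y ^ℚ 4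
    ≡⟨ cong (_+ y ^ℚ 4) (Σ^4≡newton₄ x p) ⟩
  newton₄ (e 1) (e 2) (e 3) (e 4) + y ^ℚ 4
    ≡⟨ solve 5 (λ y e₁ e₂ e₃ e₄ →
         let newton₄′ = λ e₁ e₂ e₃ e₄ → e₁ :* e₁ :* e₁ :* e₁ :- con (fromℕ 4) :* e₁ :* e₁ :* e₂
                          :+ con (fromℕ 2) :* e₂ :* e₂ :+ con (fromℕ 4) :* e₁ :* e₃ :- con (fromℕ 4) :* e₄
         in newton₄′ e₁ e₂ e₃ e₄ :+ y :* (y :* (y :* (y :* con 1ℚ)))
            := newton₄′ (e₁ :+ y :* con 1ℚ) (e₂ :+ y :* e₁) (e₃ :+ y :* e₂) (e₄ :+ y :* e₃))
         refl y (e 1) (e 2) (e 3) (e 4) ⟩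
  newton₄ (e 1 + y * 1ℚ) (e 2 + y * e 1) (e 3 + y * e 2) (e 4 + y * e 3) ∎
  where
  y = x (suc p)
  e : ℕ → ℚ
  e j = elementary x j p

^ℚ-≢0 : ∀ {q} n → q ≢ 0ℚ → q ^ℚ n ≢ 0ℚ
^ℚ-≢0 zero    q≢0 ()
^ℚ-≢0 (suc n) q≢0 = *-≢0 q≢0 (^ℚ-≢0 n q≢0)

1/n⁸≡inverseSquare⁴ : ∀ n → fromℕ 1 ⊘ (fromℕ (suc n) ^ℚ 8) ≡ inverseSquare (suc n) ^ℚ 4
1/n⁸≡inverseSquare⁴ n = ⊘-unique (^ℚ-≢0 8 (fromℕ≢0 (suc n))) (begin
  x ^ℚ 4 * N ^ℚ 8
    ≡⟨ solve 2 (λ N x → x :* (x :* (x :* (x :* con 1ℚ)))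
                          :* (N :* (N :* (N :* (N :* (N :* (N :* (N :* (N :* con 1ℚ))))))))
                       := (N :* N :* x) :* ((N :* N :* x) :* ((N :* N :* x) :* ((N :* N :* x) :* con 1ℚ))))
         refl N x ⟩
  (N * N * x) ^ℚ 4
    ≡⟨ cong (_^ℚ 4) (square*inverseSquare n) ⟩
  1ℚ ^ℚ 4 ∎)
  where
  N = fromℕ (suc n)
  x = inverseSquare (suc n)

theorem9-rhs : ℚ → ℚ → ℚ → ℚ → ℚ
theorem9-rhs r₂ r₃ r₄ r₅ = (fromℕ 8 ⊘ fromℕ 14175)
  * ((((fromℕ 350 * (r₂ ^ℚ 4)) - (fromℕ 420 * r₃ * (r₂ ^ℚ 2)))
      + (fromℕ 63 * (r₃ ^ℚ 2)) + (fromℕ 60 * r₄ * r₂)) - (fromℕ 5 * r₅))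

newton₄≡theorem9-rhs : ∀ e₁ e₂ e₃ e₄ →
  newton₄ e₁ e₂ e₃ e₄ ≡ theorem9-rhs (K 1 * e₁) (K 2 * e₂) (K 3 * e₃) (K 4 * e₄)
newton₄≡theorem9-rhs = solve 4 (λ e₁ e₂ e₃ e₄ →
  e₁ :* e₁ :* e₁ :* e₁ :- con (fromℕ 4) :* e₁ :* e₁ :* e₂ :+ con (fromℕ 2) :* e₂ :* e₂
    :+ con (fromℕ 4) :* e₁ :* e₃ :- con (fromℕ 4) :* e₄
  := let r₂ = con (K 1) :* e₁ ; r₃ = con (K 2) :* e₂ ; r₄ = con (K 3) :* e₃ ; r₅ = con (K 4) :* e₄ in
     con (fromℕ 8 ⊘ fromℕ 14175)
       :* ((((con (fromℕ 350) :* (r₂ :* (r₂ :* (r₂ :* (r₂ :* con 1ℚ)))))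
             :- (con (fromℕ 420) :* r₃ :* (r₂ :* (r₂ :* con 1ℚ))))
            :+ (con (fromℕ 63) :* (r₃ :* (r₃ :* con 1ℚ))) :+ (con (fromℕ 60) :* r₄ :* r₂))
           :- (con (fromℕ 5) :* r₅)))
  refl

mainTheorem9 : (v : ℕ) → 5 < v →
    let r = λ (m : ℕ) → c (2 ℕ.* v) (v ∸ m) ⊘ c (2 ℕ.* v) (v ∸ 1) in
    Σ< (v ∸ 1) (λ i → fromℕ 1 ⊘ (fromℕ (suc i) ^ℚ 8))
      ≡ (fromℕ 8 ⊘ fromℕ 14175)
        * ((((fromℕ 350 * (r 2 ^ℚ 4)) - (fromℕ 420 * r 3 * (r 2 ^ℚ 2)))
            + (fromℕ 63 * (r 3 ^ℚ 2)) + (fromℕ 60 * r 4 * r 2)) - (fromℕ 5 * r 5))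
mainTheorem9 (suc p) (s≤s 5≤p) = begin
  Σ< p (λ i → fromℕ 1 ⊘ (fromℕ (suc i) ^ℚ 8))
    ≡⟨ Σ<-cong p (λ {i} _ → 1/n⁸≡inverseSquare⁴ i) ⟩
  Σ< p (λ i → inverseSquare (suc i) ^ℚ 4)
    ≡⟨ Σ^4≡newton₄ inverseSquare p ⟩
  newton₄ (e 1) (e 2) (e 3) (e 4)
    ≡⟨ newton₄≡theorem9-rhs (e 1) (e 2) (e 3) (e 4) ⟩
  theorem9-rhs (K 1 * e 1) (K 2 * e 2) (K 3 * e 3) (K 4 * e 4)
    ≡⟨ cong₂ (λ a b → theorem9-rhs a b (K 3 * e 3) (K 4 * e 4)) (ratio 1 (ℕ.≤ᵇ⇒≤ 1 4 _))
                                                                (ratio 2 (ℕ.≤ᵇ⇒≤ 2 4 _)) ⟨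
  theorem9-rhs (r 2) (r 3) (K 3 * e 3) (K 4 * e 4)
    ≡⟨ cong₂ (theorem9-rhs (r 2) (r 3)) (ratio 3 (ℕ.≤ᵇ⇒≤ 3 4 _)) (ratio 4 ℕ.≤-refl) ⟨
  theorem9-rhs (r 2) (r 3) (r 4) (r 5) ∎
  where
  e : ℕ → ℚ
  e j = elementary inverseSquare j p
  r : ℕ → ℚ
  r m = c (2 ℕ.* suc p) (suc p ∸ m) ⊘ c (2 ℕ.* suc p) p
  ratio : ∀ j → j ≤ 4 → r (suc j) ≡ K j * e j
  ratio j j≤4 = c-ratio p j (ℕ.≤-trans j≤4 (ℕ.<⇒≤ 5≤p))
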